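{- Let $\varphi$ be an LTL formula in negation normal form, let $X \subseteq \mu(\varphi)$, let $w$ be an infinite word over $2^{Ap}$, and for $i \geq 0$ let $\varphi_i := \mathit{af}(\varphi, w_{0i})$. If $w \models \varphi[X]_\nu$, then $w_i \models \varphi_i[X]_\nu$ for all $i > 0$.
   Context: LTL formulas in negation normal form over a finite set $Ap$: $\varphi ::= \mathbf{tt} \mid \mathbf{ff} \mid a \mid \neg a \mid \varphi\wedge\varphi \mid \varphi\vee\varphi \mid \mathbf{X}\varphi \mid \mathbf{F}\varphi \mid \mathbf{G}\varphi \mid \varphi\mathbf{U}\varphi \mid \varphi\mathbf{W}\varphi \mid \varphi\mathbf{M}\varphi \mid \varphi\mathbf{R}\varphi$, with standard semantics on infinite words ($\varphi\mathbf{W}\psi\equiv\mathbf{G}\varphi\vee\varphi\mathbf{U}\psi$; $w\models\varphi\mathbf{M}\psi$ iff $\exists k.\,w_k\models\varphi \wedge \forall j\le k.\,w_j\models\psi$; $\varphi\mathbf{R}\psi\equiv\mathbf{G}\psi\vee\varphi\mathbf{M}\psi$). $w_i$ is the suffix $w[i]w[i+1]\cdots$, $w_{ij}$ the finite infix $w[i]\cdots w[j-1]$. $\mu(\varphi)$ is the set of subformulas of $\varphi$ of the form $\mathbf{F}\psi$, $\psi_1\mathbf{U}\psi_2$, $\psi_1\mathbf{M}\psi_2$. The function $\mathit{af}$: for a letter $\nu\in 2^{Ap}$, $\mathit{af}(a,\nu)=\mathbf{tt}$ if $a\in\nu$ else $\mathbf{ff}$; $\mathit{af}(\neg a,\nu)=\mathbf{ff}$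 if $a\in\nu$ else $\mathbf{tt}$; $\mathit{af}(\mathbf{tt},\nu)=\mathbf{tt}$, $\mathit{af}(\mathbf{ff},\nu)=\mathbf{ff}$; $\mathit{af}$ commutes with $\wedge,\vee$; $\mathit{af}(\mathbf{X}\varphi,\nu)=\varphi$; $\mathit{af}(\mathbf{F}\varphi,\nu)=\mathit{af}(\varphi,\nu)\vee\mathbf{F}\varphi$; $\mathit{af}(\mathbf{G}\varphi,\nu)=\mathit{af}(\varphi,\nu)\wedge\mathbf{G}\varphi$; $\mathit{af}(\varphi\mathbf{U}\psi,\nu)=\mathit{af}(\psi,\nu)\vee(\mathit{af}(\varphi,\nu)\wedge\varphi\mathbf{U}\psi)$, same shape for $\mathbf{W}$; $\mathit{af}(\varphi\mathbf{M}\psi,\nu)=\mathit{af}(\psi,\nu)\wedge(\mathit{af}(\varphi,\nu)\vee\varphi\mathbf{M}\psi)$, same shape for $\mathbf{R}$; extended to finite words by $\mathit{af}(\varphi,\epsilon)=\varphi$, $\mathit{af}(\varphi,\nu u)=\mathit{af}(\mathit{af}(\varphi,\nu),u)$. For a set $X$ of formulas, $\psi[X]_\nu$: it is $\psi$ for $\psi\in\{\mathbf{tt},\mathbf{ff},a,\neg a\}$; it commutes with $\mathbf{X},\mathbf{G},\wedge,\vee,\mathbf{W},\mathbf{R}$; $(\mathbf{F}\psi)[X]_\nu=\mathbf{tt}$ if $\mathbf{F}\psi\in X$, else $\mathbf{ff}$; $(\psi_1\mathbf{U}\psi_2)[X]_\nu=(\psi_1[X]_\nu)\mathbf{W}(\psi_2[X]_\nu)$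 if $\psi_1\mathbf{U}\psi_2\in X$, else $\mathbf{ff}$; $(\psi_1\mathbf{M}\psi_2)[X]_\nu=(\psi_1[X]_\nu)\mathbf{R}(\psi_2[X]_\nu)$ if $\psi_1\mathbf{M}\psi_2\in X$, else $\mathbf{ff}$. -}

module Defs where

open import Data.Nat using (ℕ; zero; suc; _+_; _<_; _≤_)
open import Data.Fin using (Fin)
open import Data.Bool using (Bool; true; false; if_then_else_)
open import Data.List using (List; []; _∷_; map; upTo)
open import Data.Product using (Σ; _×_; ∃)
open import Data.Sum using (_⊎_)
open import Data.Unit using (⊤)
open import Data.Empty using (⊥)
open import Relation.Binary.PropositionalEquality using (_≡_)

data LTL (n : ℕ) : Set where
  tt ff       : LTL n
  atom natom  : Fin n → LTL n
  _∧ₗ_ _∨ₗ_   : LTL n → LTL n → LTL n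
  Xₗ Fₗ Gₗ    : LTL n → LTL n
  _Uₗ_ _Wₗ_ _Mₗ_ _Rₗ_ : LTL n → LTL n → LTL n

-- letters are elements of 2^Ap, i.e. subsets of Fin n (characteristic functions)
Letter : ℕ → Set
Letter n = Fin n → Bool

Word : ℕ → Set
Word n = ℕ → Letter n

suffix : ∀ {n} → Word n → ℕ → Word n
suffix w i k = w (i + k)

-- finite infix w_{0i} = w[0] ... w[i-1]
prefix : ∀ {n} → Word n → ℕ → List (Letter n)
prefix w i = map w (upTo i)

infix 4 _⊨_
_⊨_ : ∀ {n} → Word n → LTL n → Set
w ⊨ tt = ⊤
w ⊨ ff = ⊥
w ⊨ atom a = w 0 a ≡ true
w ⊨ natom a = w 0 a ≡ false
w ⊨ (φ ∧ₗ ψ) = (w ⊨ φ) × (w ⊨ ψ)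
w ⊨ (φ ∨ₗ ψ) = (w ⊨ φ) ⊎ (w ⊨ ψ)
w ⊨ Xₗ φ = suffix w 1 ⊨ φ
w ⊨ Fₗ φ = ∃ λ k → suffix w k ⊨ φ
w ⊨ Gₗ φ = ∀ k → suffix w k ⊨ φ
w ⊨ (φ Uₗ ψ) = ∃ λ k → (suffix w k ⊨ ψ) × (∀ j → j < k → suffix w j ⊨ φ)
w ⊨ (φ Wₗ ψ) = (∀ k → suffix w k ⊨ φ)
             ⊎ (∃ λ k → (suffix w k ⊨ ψ) × (∀ j → j < k → suffix w j ⊨ φ))
w ⊨ (φ Mₗ ψ) = ∃ λ k → (suffix w k ⊨ φ) × (∀ j → j ≤ k → suffix w j ⊨ ψ)
w ⊨ (φ Rₗ ψ) = (∀ k → suffix w k ⊨ ψ)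
             ⊎ (∃ λ k → (suffix w k ⊨ φ) × (∀ j → j ≤ k → suffix w j ⊨ ψ))

af₁ : ∀ {n} → LTL n → Letter n → LTL n
af₁ tt ν = tt
af₁ ff ν = ff
af₁ (atom a) ν = if ν a then tt else ff
af₁ (natom a) ν = if ν a then ff else tt
af₁ (φ ∧ₗ ψ) ν = af₁ φ ν ∧ₗ af₁ ψ ν
af₁ (φ ∨ₗ ψ) ν = af₁ φ ν ∨ₗ af₁ ψ ν
af₁ (Xₗ φ) ν = φ
af₁ (Fₗ φ) ν = af₁ φ ν ∨ₗ Fₗ φ
af₁ (Gₗ φ) ν = af₁ φ ν ∧ₗ Gₗ φ
af₁ (φ Uₗ ψ) ν = af₁ ψ ν ∨ₗ (af₁ φ ν ∧ₗ (φ Uₗ ψ))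
af₁ (φ Wₗ ψ) ν = af₁ ψ ν ∨ₗ (af₁ φ ν ∧ₗ (φ Wₗ ψ))
af₁ (φ Mₗ ψ) ν = af₁ ψ ν ∧ₗ (af₁ φ ν ∨ₗ (φ Mₗ ψ))
af₁ (φ Rₗ ψ) ν = af₁ ψ ν ∧ₗ (af₁ φ ν ∨ₗ (φ Rₗ ψ))

af : ∀ {n} → LTL n → List (Letter n) → LTL n
af φ [] = φ
af φ (ν ∷ u) = af (af₁ φ ν) u

-- sets of formulas are given by characteristic functions
FSet : ℕ → Set
FSet n = LTL n → Bool

_[_]ν : ∀ {n} → LTL n → FSet n → LTL n
tt [ X ]ν = tt
ff [ X ]ν = ff
atom a [ X ]ν = atom a
natom a [ X ]ν = natom a
(φ ∧ₗ ψ) [ X ]ν = (φ [ X ]ν) ∧ₗ (ψ [ X ]ν)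
(φ ∨ₗ ψ) [ X ]ν = (φ [ X ]ν) ∨ₗ (ψ [ X ]ν)
Xₗ φ [ X ]ν = Xₗ (φ [ X ]ν)
Gₗ φ [ X ]ν = Gₗ (φ [ X ]ν)
(φ Wₗ ψ) [ X ]ν = (φ [ X ]ν) Wₗ (ψ [ X ]ν)
(φ Rₗ ψ) [ X ]ν = (φ [ X ]ν) Rₗ (ψ [ X ]ν)
Fₗ φ [ X ]ν = if X (Fₗ φ) then tt else ff
(φ Uₗ ψ) [ X ]ν = if X (φ Uₗ ψ) then (φ [ X ]ν) Wₗ (ψ [ X ]ν) else ff
(φ Mₗ ψ) [ X ]ν = if X (φ Mₗ ψ) then (φ [ X ]ν) Rₗ (ψ [ X ]ν) else ff

data _⊑_ {n : ℕ} : LTL n → LTL n → Set where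
  refl⊑ : ∀ {φ} → φ ⊑ φ
  ∧l : ∀ {χ φ ψ} → χ ⊑ φ → χ ⊑ (φ ∧ₗ ψ)
  ∧r : ∀ {χ φ ψ} → χ ⊑ ψ → χ ⊑ (φ ∧ₗ ψ)
  ∨l : ∀ {χ φ ψ} → χ ⊑ φ → χ ⊑ (φ ∨ₗ ψ)
  ∨r : ∀ {χ φ ψ} → χ ⊑ ψ → χ ⊑ (φ ∨ₗ ψ)
  X⊑ : ∀ {χ φ} → χ ⊑ φ → χ ⊑ Xₗ φ
  F⊑ : ∀ {χ φ} → χ ⊑ φ → χ ⊑ Fₗ φ
  G⊑ : ∀ {χ φ} → χ ⊑ φ → χ ⊑ Gₗ φ
  Ul : ∀ {χ φ ψ} → χ ⊑ φ → χ ⊑ (φ Uₗ ψ)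
  Ur : ∀ {χ φ ψ} → χ ⊑ ψ → χ ⊑ (φ Uₗ ψ)
  Wl : ∀ {χ φ ψ} → χ ⊑ φ → χ ⊑ (φ Wₗ ψ)
  Wr : ∀ {χ φ ψ} → χ ⊑ ψ → χ ⊑ (φ Wₗ ψ)
  Ml : ∀ {χ φ ψ} → χ ⊑ φ → χ ⊑ (φ Mₗ ψ)
  Mr : ∀ {χ φ ψ} → χ ⊑ ψ → χ ⊑ (φ Mₗ ψ)
  Rl : ∀ {χ φ ψ} → χ ⊑ φ → χ ⊑ (φ Rₗ ψ)
  Rr : ∀ {χ φ ψ} → χ ⊑ ψ → χ ⊑ (φ Rₗ ψ)

data IsμForm {n : ℕ} : LTL n → Set where
  isF : ∀ {φ} → IsμForm (Fₗ φ)
  isU : ∀ {φ ψ} → IsμForm (φ Uₗ ψ)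
  isM : ∀ {φ ψ} → IsμForm (φ Mₗ ψ)

_∈μ_ : ∀ {n} → LTL n → LTL n → Set
ψ ∈μ φ = IsμForm ψ × (ψ ⊑ φ)

_⊆μ_ : ∀ {n} → FSet n → LTL n → Set
X ⊆μ φ = ∀ ψ → X ψ ≡ true → ψ ∈μ φ

-- Reading one letter preserves satisfaction of the ν-approximation: w ⊨ ψ[X]ν implies
-- w₁ ⊨ af(ψ, w[0])[X]ν, by induction on ψ. Under [X]ν the formulas F, U, M become tt, ff,
-- W or R, so the only temporal content is the one-step expansion laws of G, W and R, which
-- match the shape of af exactly. Iterating along the word gives the claim at every position.
module Submission where

open import Defs
open import Data.Nat using (_<_; zero; suc; z≤n; s≤s)
open import Data.Bool using (true; false)
open import Data.List using (_∷_; applyUpTo)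
open import Data.List.Properties using (map-upTo)
open import Data.Product as Product using (_,_; _×_)
open import Data.Sum as Sum using (_⊎_; inj₁; inj₂)
open import Data.Unit using (tt)
open import Function using (_$_)
open import Relation.Binary.PropositionalEquality using (_≡_; cong; sym; subst; module ≡-Reasoning)

W-unfold : ∀ {n} (φ ψ : LTL n) (w : Word n)
  → w ⊨ (φ Wₗ ψ) → (w ⊨ ψ) ⊎ ((w ⊨ φ) × (suffix w 1 ⊨ (φ Wₗ ψ)))
W-unfold φ ψ w (inj₁ always) = inj₂ (always 0 , inj₁ (λ k → always (suc k)))
W-unfold φ ψ w (inj₂ (zero , now , _)) = inj₁ now
W-unfold φ ψ w (inj₂ (suc k , later , before)) =
  inj₂ (before 0 (s≤s z≤n) , inj₂ (k , later , λ j j<k → before (suc j) (s≤s j<k)))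

R-unfold : ∀ {n} (φ ψ : LTL n) (w : Word n)
  → w ⊨ (φ Rₗ ψ) → (w ⊨ ψ) × ((w ⊨ φ) ⊎ (suffix w 1 ⊨ (φ Rₗ ψ)))
R-unfold φ ψ w (inj₁ always) = always 0 , inj₂ (inj₁ (λ k → always (suc k)))
R-unfold φ ψ w (inj₂ (zero , now , upto)) = upto 0 z≤n , inj₁ now
R-unfold φ ψ w (inj₂ (suc k , later , upto)) =
  upto 0 z≤n , inj₂ (inj₂ (k , later , λ j j≤k → upto (suc j) (s≤s j≤k)))

⊨[]ν-af₁ : ∀ {n} (X : FSet n) (ψ : LTL n) (w : Word n)
  → w ⊨ (ψ [ X ]ν) → suffix w 1 ⊨ (af₁ ψ (w 0) [ X ]ν)
⊨[]ν-af₁ X tt w _ = tt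
⊨[]ν-af₁ X (atom a) w holds with w 0 a
... | true = tt
⊨[]ν-af₁ X (atom a) w () | false
⊨[]ν-af₁ X (natom a) w holds with w 0 a
⊨[]ν-af₁ X (natom a) w () | true
... | false = tt
⊨[]ν-af₁ X (φ ∧ₗ ψ) w (p , q) = ⊨[]ν-af₁ X φ w p , ⊨[]ν-af₁ X ψ w q
⊨[]ν-af₁ X (φ ∨ₗ ψ) w (inj₁ p) = inj₁ (⊨[]ν-af₁ X φ w p)
⊨[]ν-af₁ X (φ ∨ₗ ψ) w (inj₂ q) = inj₂ (⊨[]ν-af₁ X ψ w q)
⊨[]ν-af₁ X (Xₗ φ) w holds = holds
⊨[]ν-af₁ X (Gₗ φ) w always = ⊨[]ν-af₁ X φ w (always 0) , λ k → always (suc k)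
⊨[]ν-af₁ X (Fₗ φ) w holds with X (Fₗ φ)
... | true = inj₂ tt
⊨[]ν-af₁ X (Fₗ φ) w () | false
⊨[]ν-af₁ X (φ Uₗ ψ) w holds with X (φ Uₗ ψ)
... | true = Sum.map (⊨[]ν-af₁ X ψ w) (Product.map₁ (⊨[]ν-af₁ X φ w))
    (W-unfold (φ [ X ]ν) (ψ [ X ]ν) w holds)
⊨[]ν-af₁ X (φ Uₗ ψ) w () | false
⊨[]ν-af₁ X (φ Wₗ ψ) w holds = Sum.map (⊨[]ν-af₁ X ψ w) (Product.map₁ (⊨[]ν-af₁ X φ w))
    (W-unfold (φ [ X ]ν) (ψ [ X ]ν) w holds)
⊨[]ν-af₁ X (φ Mₗ ψ) w holds with X (φ Mₗ ψ)
... | true = Product.map (⊨[]ν-af₁ X ψ w) (Sum.map₁ (⊨[]ν-af₁ X φ w))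
    (R-unfold (φ [ X ]ν) (ψ [ X ]ν) w holds)
⊨[]ν-af₁ X (φ Mₗ ψ) w () | false
⊨[]ν-af₁ X (φ Rₗ ψ) w holds = Product.map (⊨[]ν-af₁ X ψ w) (Sum.map₁ (⊨[]ν-af₁ X φ w))
    (R-unfold (φ [ X ]ν) (ψ [ X ]ν) w holds)

prefix-suc : ∀ {n} (w : Word n) i → prefix w (suc i) ≡ w 0 ∷ prefix (suffix w 1) i
prefix-suc w i = begin
  prefix w (suc i)                      ≡⟨ map-upTo w (suc i) ⟩
  w 0 ∷ applyUpTo (suffix w 1) i        ≡⟨ cong (w 0 ∷_) (sym (map-upTo (suffix w 1) i)) ⟩
  w 0 ∷ prefix (suffix w 1) i           ∎
  where open ≡-Reasoning

⊨[]ν-af-prefix : ∀ {n} (X : FSet n) (φ : LTL n) (w : Word n)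
  → w ⊨ (φ [ X ]ν) → ∀ i → suffix w i ⊨ (af φ (prefix w i) [ X ]ν)
⊨[]ν-af-prefix X φ w holds zero = holds
⊨[]ν-af-prefix X φ w holds (suc i) =
  subst (λ u → suffix w (suc i) ⊨ (af φ u [ X ]ν)) (sym (prefix-suc w i)) $
  ⊨[]ν-af-prefix X (af₁ φ (w 0)) (suffix w 1) (⊨[]ν-af₁ X φ w holds) i

lemma6p1 : ∀ {n} (φ : LTL n) (X : FSet n) → X ⊆μ φ → (w : Word n)
    → w ⊨ (φ [ X ]ν)
    → ∀ i → 0 < i → suffix w i ⊨ (af φ (prefix w i) [ X ]ν)
lemma6p1 φ X _ w holds i _ = ⊨[]ν-af-prefix X φ w holds i
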